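{- Let $2\le k\le n-2$, let $J\in\binom{[n]}{k}$ be nonfrozen, and let $a,b,c,d\in[n]$ be distinct and appear in this cyclic order in $(1,2,\ldots,n)$, such that $e_J$, $e_J+(e_a-e_b)+(e_c-e_d)$, $e_J+(e_a-e_b)$, $e_J+(e_c-e_d)$ all lie in $\Delta_{k,n}$. Define for vertices $e_I$ of $\Delta_{k,n}$ $$\mathcal O_{(a,b,c,d)}(\rho_{e_J})(e_I)=\rho_{e_J}(e_I)+\rho_{e_J+e_a-e_b+e_c-e_d}(e_I)-\rho_{e_J+e_a-e_b}(e_I)-\rho_{e_J+e_c-e_d}(e_I).$$ Then $\mathcal O_{(a,b,c,d)}(\rho_{e_J})(e_I)\le0$ for all vertices $e_I$ of $\Delta_{k,n}$; there exists a vertex $e_I$ with $\mathcal O_{(a,b,c,d)}(\rho_{e_J})(e_I)<0$; and $\mathcal O_{(a,b,c,d)}(\rho_{e_J})(e_{\{j,j+1,\ldots,j+k-1\}})=0$ for each of the $n$ frozen vertices (indices mod $n$).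
   Context: $\Delta_{k,n}=\{x\in[0,1]^n:\sum x_j=k\}$, $e_S=\sum_{s\in S}e_s$. For $t=1,\ldots,n$ let $L_t(x)=x_{t+1}+2x_{t+2}+\cdots+(n-1)x_{t-1}$ (indices mod $n$). For $u,w\in\mathbb R^n$ set $\rho_u(w)=-\frac1n\min\{L_1(w-u),\ldots,L_n(w-u)\}$. A $k$-subset is frozen if it is a cyclic interval $\{j,\ldots,j+k-1\}$ mod $n$, else nonfrozen. -}

module Defs where

open import Data.Bool using (Bool; true; false; if_then_else_)
open import Data.Nat as ℕ using (ℕ; zero; suc; NonZero; _%_; _<ᵇ_; _∸_)
open import Data.Nat.DivMod using (_mod_)
open import Data.Fin as Fin using (Fin; toℕ)
open import Data.Fin.Subset using (Subset; _∈_)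
open import Data.Vec using (lookup; tabulate)
open import Data.Integer as ℤ using (ℤ; +_; _⊓_)
open import Data.Rational as ℚ using (ℚ)
open import Data.Product using (Σ; _×_; ∃)
open import Relation.Binary.PropositionalEquality using (_≡_)
open import Relation.Nullary.Decidable using (does)
import Relation.Nullary

-- Integer vectors in ℤ^n, coordinates indexed by Fin n (0-based: Fin position p ↔ paper index p+1)
Vecℤ : ℕ → Set
Vecℤ n = Fin n → ℤ

_⊕_ : ∀ {n} → Vecℤ n → Vecℤ n → Vecℤ n
(x ⊕ y) j = x j ℤ.+ y j

_⊖_ : ∀ {n} → Vecℤ n → Vecℤ n → Vecℤ n
(x ⊖ y) j = x j ℤ.- y j

infixl 6 _⊕_ _⊖_

eᵢ : ∀ {n} → Fin n → Vecℤ n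
eᵢ a j = if does (j Fin.≟ a) then + 1 else + 0

e : ∀ {n} → Subset n → Vecℤ n
e S j = if lookup S j then + 1 else + 0

sumTo : ℕ → (ℕ → ℤ) → ℤ
sumTo zero f = + 0
sumTo (suc m) f = sumTo m f ℤ.+ f m

sumVec : ∀ {n} → Vecℤ n → ℤ
sumVec {n} x = sumTo n (λ i → go i)
  where
  go : ℕ → ℤ
  go i with i ℕ.<? n
  ... | Relation.Nullary.yes p = x (Fin.fromℕ< p)
  ... | Relation.Nullary.no _ = + 0

InΔ : (k n : ℕ) → Vecℤ n → Set
InΔ k n x = ((j : Fin n) → (+ 0 ℤ.≤ x j) × (x j ℤ.≤ + 1)) × (sumVec x ≡ + k)

L : ∀ {n} .{{_ : NonZero n}} → Fin n → Vecℤ n → ℤ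
L {n} t x = sumTo n (λ i → (+ i) ℤ.* x ((toℕ t ℕ.+ i) mod n))

minFin : ∀ m → (Fin (suc m) → ℤ) → ℤ
minFin zero f = f Fin.zero
minFin (suc m) f = f Fin.zero ⊓ minFin m (λ i → f (Fin.suc i))

minOver : ∀ n → (Fin n → ℤ) → ℤ
minOver zero f = + 0
minOver (suc m) f = minFin m f

ρ : ∀ {n} .{{_ : NonZero n}} → Vecℤ n → Vecℤ n → ℚ
ρ {n} u w = (ℤ.- minOver n (λ t → L t (w ⊖ u))) ℚ./ n

-- the frozen k-subset {j, j+1, ..., j+k-1} (mod n)
interval : ∀ {n} .{{_ : NonZero n}} → ℕ → Fin n → Subset n
interval {n} k j = tabulate (λ i → ((toℕ i ℕ.+ (n ∸ toℕ j)) % n) <ᵇ k)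

Frozen : ∀ {n} .{{_ : NonZero n}} → ℕ → Subset n → Set
Frozen {n} k J = ∃ λ (j : Fin n) → J ≡ interval k j

CyclicOrder : ∀ {n} → Fin n → Fin n → Fin n → Fin n → Set
CyclicOrder a b c d =
  (a Fin.< b × b Fin.< c × c Fin.< d) Data.Sum.⊎
  ((b Fin.< c × c Fin.< d × d Fin.< a) Data.Sum.⊎
  ((c Fin.< d × d Fin.< a × a Fin.< b) Data.Sum.⊎
   (d Fin.< a × a Fin.< b × b Fin.< c)))
  where import Data.Sum

𝒪 : ∀ {n} .{{_ : NonZero n}} → Fin n → Fin n → Fin n → Fin n → Subset n → Subset n → ℚ
𝒪 a b c d J I =
  ((ρ (e J) (e I) ℚ.+ ρ (e J ⊕ eᵢ a ⊖ eᵢ b ⊕ eᵢ c ⊖ eᵢ d) (e I))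
    ℚ.- ρ (e J ⊕ eᵢ a ⊖ eᵢ b) (e I)) ℚ.- ρ (e J ⊕ eᵢ c ⊖ eᵢ d) (e I)

{-# OPTIONS --safe #-}
module Submission where

-- Write M_I(u) = min_t L_t(e_I - u), so that n 𝒪(e_I) = M_I(J+ab) + M_I(J+cd) - M_I(J) - M_I(J+ab+cd),
-- where each L_t is linear. For a periodic zero-sum sequence X one has L_{t+1}(X) = L_t(X) + n X_t,
-- so L_t(e_a - e_b) is a constant plus n times the partial sum [a < t] - [b < t], a step function
-- that is minimal exactly off the cyclic arc (a, b]. The arcs (a, b] and (c, d] are disjoint because
-- a, b, c, d are in cyclic order, so at every t one of the two step functions is minimal; evaluating
-- the left-hand minima at the minimisers of L(e_I - e_J) and L(e_I - e_J+ab+cd) gives 𝒪 ≤ 0. At I = J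
-- the first of these vanishes and neither step function is constant, which makes the bound strict.
-- For a frozen I = {j, ..., j+k-1} and any u in Δ_{k,n} all partial sums of e_I - u starting at j are
-- nonnegative, so t = j minimises all four L_t(e_I - u) at once and the minima cancel by linearity.

open import Defs

module _ where
  open import Algebra.Properties.AbelianGroup using (∙-cancelˡ)
  open import Algebra.Properties.CommutativeSemigroup using (interchange)
  open import Data.Bool using (true; false; if_then_else_)
  open import Data.Fin as Fin using (Fin; toℕ)
  import Data.Fin.Properties as Fin
  open import Data.Fin.Subset using (Subset)
  open import Data.Integer using (ℤ; +_; -_; _+_; _-_; _*_; _⊓_; _≤_; _<_; -1ℤ; +≤+; +<+; -<+; Positive; positive)
  open import Data.Integer.Properties
  open import Data.Integer.Tactic.RingSolver using (solve-∀)
  open import Data.Nat as ℕ using (ℕ; zero; suc; NonZero; z≤n; _<ᵇ_; _∸_)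
  open import Data.Nat.DivMod as ℕ using (_mod_; _%_)
  import Data.Nat.Properties as ℕ
  open import Data.Product using (∃; _×_; _,_; proj₁; proj₂)
  import Data.Rational as ℚ
  open import Data.Rational using (0ℚ; _/_)
  import Data.Rational.Properties as ℚ
  import Data.Rational.Unnormalised as ℚᵘ
  open import Data.Rational.Unnormalised using (mkℚᵘ; *≡*; *≤*; *<*)
  import Data.Rational.Unnormalised.Properties as ℚᵘ
  open import Data.Sum as Sum using (_⊎_; inj₁; inj₂)
  open import Data.Vec.Properties using (lookup∘tabulate)
  open import Relation.Binary.PropositionalEquality
  open import Relation.Binary.Definitions using (tri<; tri≈; tri>)
  open import Relation.Nullary using (yes; no; ofʸ; ofⁿ; contradiction)

  sumTo-cong : ∀ m {f g : ℕ → ℤ} → (∀ i → i ℕ.< m → f i ≡ g i) → sumTo m f ≡ sumTo m g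
  sumTo-cong zero    f≗g = refl
  sumTo-cong (suc m) f≗g =
    cong₂ _+_ (sumTo-cong m (λ i i<m → f≗g i (ℕ.m<n⇒m<1+n i<m))) (f≗g m ℕ.≤-refl)

  sumTo-+ : ∀ m (f g : ℕ → ℤ) → sumTo m (λ i → f i + g i) ≡ sumTo m f + sumTo m g
  sumTo-+ zero    f g = refl
  sumTo-+ (suc m) f g = trans (cong (_+ (f m + g m)) (sumTo-+ m f g))
                              (interchange +-commutativeSemigroup (sumTo m f) (sumTo m g) (f m) (g m))

  sumTo-neg : ∀ m (f : ℕ → ℤ) → sumTo m (λ i → - f i) ≡ - sumTo m f
  sumTo-neg zero    f = refl
  sumTo-neg (suc m) f = trans (cong (_- f m) (sumTo-neg m f)) (sym (neg-distrib-+ (sumTo m f) (f m)))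

  sumTo-- : ∀ m (f g : ℕ → ℤ) → sumTo m (λ i → f i - g i) ≡ sumTo m f - sumTo m g
  sumTo-- m f g = trans (sumTo-+ m f (λ i → - g i)) (cong (λ r → sumTo m f + r) (sumTo-neg m g))

  sumTo-head : ∀ m (f : ℕ → ℤ) → sumTo (suc m) f ≡ f 0 + sumTo m (λ i → f (suc i))
  sumTo-head zero    f = +-comm (+ 0) (f 0)
  sumTo-head (suc m) f = trans (cong (_+ f (suc m)) (sumTo-head m f)) (+-assoc (f 0) _ _)

  sumTo-one : ∀ m → sumTo m (λ _ → + 1) ≡ + m
  sumTo-one zero    = refl
  sumTo-one (suc m) = trans (cong (_+ + 1) (sumTo-one m)) (cong +_ (ℕ.+-comm m 1))

  sumTo-mono : ∀ m {f g : ℕ → ℤ} → (∀ i → i ℕ.< m → f i ≤ g i) → sumTo m f ≤ sumTo m g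
  sumTo-mono zero    f≤g = ≤-refl
  sumTo-mono (suc m) f≤g =
    +-mono-≤ (sumTo-mono m (λ i i<m → f≤g i (ℕ.m<n⇒m<1+n i<m))) (f≤g m ℕ.≤-refl)

  sumTo-monoˡ : ∀ {m m′} (f : ℕ → ℤ) → (∀ i → + 0 ≤ f i) → m ℕ.≤ m′ → sumTo m f ≤ sumTo m′ f
  sumTo-monoˡ {m} f f≥0 m≤m′ with ℕ.m≤n⇒∃[o]m+o≡n m≤m′
  ... | o , refl = sumTo-≤-+ o
    where
    sumTo-≤-+ : ∀ o → sumTo m f ≤ sumTo (m ℕ.+ o) f
    sumTo-≤-+ zero    = ≤-reflexive (cong (λ l → sumTo l f) (sym (ℕ.+-identityʳ m)))
    sumTo-≤-+ (suc o) rewrite ℕ.+-suc m o = begin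
      sumTo m f                              ≤⟨ sumTo-≤-+ o ⟩
      sumTo (m ℕ.+ o) f                      ≡⟨ +-identityʳ _ ⟨
      sumTo (m ℕ.+ o) f + + 0                ≤⟨ +-monoʳ-≤ (sumTo (m ℕ.+ o) f) (f≥0 (m ℕ.+ o)) ⟩
      sumTo (m ℕ.+ o) f + f (m ℕ.+ o)        ∎
      where open ≤-Reasoning

  Minimal : {A : Set} → (A → ℤ) → A → Set
  Minimal f t = ∀ s → f t ≤ f s

  minOver-≤ : ∀ {n} (f : Fin n → ℤ) i → minOver n f ≤ f i
  minOver-≤ {suc zero}    f Fin.zero    = ≤-refl
  minOver-≤ {suc (suc m)} f Fin.zero    = i⊓j≤i (f Fin.zero) _
  minOver-≤ {suc (suc m)} f (Fin.suc i) = ≤-trans (i⊓j≤j (f Fin.zero) _) (minOver-≤ (λ i → f (Fin.suc i)) i)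

  minOver-attained : ∀ {n} .{{_ : NonZero n}} (f : Fin n → ℤ) → ∃ λ i → minOver n f ≡ f i
  minOver-attained {suc zero}    f = Fin.zero , refl
  minOver-attained {suc (suc m)} f
    with ⊓-sel (f Fin.zero) (minOver (suc m) (λ i → f (Fin.suc i))) | minOver-attained {suc m} (λ i → f (Fin.suc i))
  ... | inj₁ min≡f0   | _           = Fin.zero , min≡f0
  ... | inj₂ min≡rest | i , rest≡fi = Fin.suc i , trans min≡rest rest≡fi

  minOver-cong : ∀ {n} {f g : Fin n → ℤ} → (∀ i → f i ≡ g i) → minOver n f ≡ minOver n g
  minOver-cong {zero}        f≗g = refl
  minOver-cong {suc zero}    f≗g = f≗g Fin.zero
  minOver-cong {suc (suc m)} f≗g = cong₂ _⊓_ (f≗g Fin.zero) (minOver-cong (λ i → f≗g (Fin.suc i)))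

  minOver-minimal : ∀ {n} .{{_ : NonZero n}} {f : Fin n → ℤ} {j} → Minimal f j → minOver n f ≡ f j
  minOver-minimal {f = f} {j} j-min with minOver-attained f
  ... | i , min≡fi = ≤-antisym (minOver-≤ f j) (subst (f j ≤_) (sym min≡fi) (j-min i))

  -- Evaluate the left-hand minima at the minimisers s of H and t of H - A - C, trading
  -- A s or C s for its value at t, where it is minimal.
  minOver-exchange : ∀ {n} .{{_ : NonZero n}} (H A C : Fin n → ℤ) → (∀ t → Minimal A t ⊎ Minimal C t) →
                     minOver n (λ t → H t - A t) + minOver n (λ t → H t - C t)
                       ≤ minOver n H + minOver n (λ t → H t - A t - C t)
  minOver-exchange {n} H A C A∨C with minOver-attained H | minOver-attained (λ t → H t - A t - C t)
  ... | s , minH≡Hs | t , min≡Ht with A∨C t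
  ... | inj₁ A-min = begin
      minOver n (λ t → H t - A t) + minOver n (λ t → H t - C t)
        ≤⟨ +-mono-≤ (minOver-≤ _ s) (minOver-≤ _ t) ⟩
      (H s - A s) + (H t - C t)
        ≤⟨ +-monoˡ-≤ (H t - C t) (+-monoʳ-≤ (H s) (neg-mono-≤ (A-min s))) ⟩
      (H s - A t) + (H t - C t)
        ≡⟨ regroup (H s) (H t) (A t) (C t) ⟩
      H s + (H t - A t - C t)
        ≡⟨ cong₂ _+_ minH≡Hs min≡Ht ⟨
      minOver n H + minOver n (λ t → H t - A t - C t)
        ∎
    where
    open ≤-Reasoning
    regroup : ∀ x y p q → (x - p) + (y - q) ≡ x + (y - p - q)
    regroup = solve-∀
  ... | inj₂ C-min = begin
      minOver n (λ t → H t - A t) + minOver n (λ t → H t - C t)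
        ≤⟨ +-mono-≤ (minOver-≤ _ t) (minOver-≤ _ s) ⟩
      (H t - A t) + (H s - C s)
        ≤⟨ +-monoʳ-≤ (H t - A t) (+-monoʳ-≤ (H s) (neg-mono-≤ (C-min s))) ⟩
      (H t - A t) + (H s - C t)
        ≡⟨ regroup (H s) (H t) (A t) (C t) ⟩
      H s + (H t - A t - C t)
        ≡⟨ cong₂ _+_ minH≡Hs min≡Ht ⟨
      minOver n H + minOver n (λ t → H t - A t - C t)
        ∎
    where
    open ≤-Reasoning
    regroup : ∀ x y p q → (y - p) + (x - q) ≡ x + (y - p - q)
    regroup = solve-∀

  minOver-exchange-strict : ∀ {n} .{{_ : NonZero n}} {h} (H A C : Fin n → ℤ) (p q : Fin n) →
                            (∀ t → H t ≡ h) → (∀ t → A t ≤ A p) → (∀ t → C t ≤ C q) →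
                            (∀ t → A t < A p ⊎ C t < C q) →
                            minOver n (λ t → H t - A t) + minOver n (λ t → H t - C t)
                              < minOver n H + minOver n (λ t → H t - A t - C t)
  minOver-exchange-strict {n} {h} H A C p q H≡h A≤Ap C≤Cq A<Ap∨C<Cq with minOver-attained (λ t → H t - A t - C t)
  ... | t , min≡Ht = begin-strict
      minOver n (λ t → H t - A t) + minOver n (λ t → H t - C t)
        ≤⟨ +-mono-≤ (minOver-≤ _ p) (minOver-≤ _ q) ⟩
      (H p - A p) + (H q - C q)
        ≡⟨ cong₂ (λ x y → (x - A p) + (y - C q)) (H≡h p) (H≡h q) ⟩
      (h - A p) + (h - C q)
        ≡⟨ regroup h h (A p) (C q) ⟩
      (h + h) - (A p + C q)
        <⟨ +-monoʳ-< (h + h) (neg-mono-< sum<) ⟩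
      (h + h) - (A t + C t)
        ≡⟨ regroup′ h h (A t) (C t) ⟩
      h + (h - A t - C t)
        ≡⟨ cong₂ _+_ minH≡h (trans min≡Ht (cong (λ x → x - A t - C t) (H≡h t))) ⟨
      minOver n H + minOver n (λ t → H t - A t - C t)
        ∎
    where
    open ≤-Reasoning
    regroup : ∀ x y a c → (x - a) + (y - c) ≡ (x + y) - (a + c)
    regroup = solve-∀
    regroup′ : ∀ x y a c → (x + y) - (a + c) ≡ x + (y - a - c)
    regroup′ = solve-∀
    minH≡h : minOver n H ≡ h
    minH≡h = trans (proj₂ (minOver-attained H)) (H≡h _)
    sum< : A t + C t < A p + C q
    sum< with A<Ap∨C<Cq t
    ... | inj₁ At<Ap = +-mono-<-≤ At<Ap (C≤Cq t)
    ... | inj₂ Ct<Cq = +-mono-≤-< (A≤Ap t) Ct<Cq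

  ⟦_<_⟧ : ℕ → ℕ → ℤ
  ⟦ a < t ⟧ = if a <ᵇ t then + 1 else + 0

  ⟦<⟧-≡1 : ∀ {a t} → a ℕ.< t → ⟦ a < t ⟧ ≡ + 1
  ⟦<⟧-≡1 {a} {t} a<t with a <ᵇ t | ℕ.<ᵇ-reflects-< a t
  ... | true  | _        = refl
  ... | false | ofⁿ a≮t = contradiction a<t a≮t

  ⟦<⟧-≡0 : ∀ {a t} → t ℕ.≤ a → ⟦ a < t ⟧ ≡ + 0
  ⟦<⟧-≡0 {a} {t} t≤a with a <ᵇ t | ℕ.<ᵇ-reflects-< a t
  ... | false | _ = refl
  ... | true  | ofʸ a<t = contradiction t≤a (ℕ.<⇒≱ a<t)

  ⟦<⟧-nonNeg : ∀ a t → + 0 ≤ ⟦ a < t ⟧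
  ⟦<⟧-nonNeg a t with a <ᵇ t
  ... | true  = +≤+ z≤n
  ... | false = +≤+ z≤n

  ⟦<⟧-≤1 : ∀ a t → ⟦ a < t ⟧ ≤ + 1
  ⟦<⟧-≤1 a t with a <ᵇ t
  ... | true  = ≤-refl
  ... | false = +≤+ z≤n

  ⟦<⟧-monoʳ : ∀ {a t t′} → t ℕ.≤ t′ → ⟦ a < t ⟧ ≤ ⟦ a < t′ ⟧
  ⟦<⟧-monoʳ {a} {t} {t′} t≤t′ with a ℕ.<? t
  ... | yes a<t = ≤-reflexive (trans (⟦<⟧-≡1 a<t) (sym (⟦<⟧-≡1 (ℕ.<-≤-trans a<t t≤t′))))
  ... | no  a≮t = subst (_≤ ⟦ a < t′ ⟧) (sym (⟦<⟧-≡0 (ℕ.≮⇒≥ a≮t))) (⟦<⟧-nonNeg a t′)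

  ⟦<⟧-antitoneˡ : ∀ {a a′ t} → a ℕ.≤ a′ → ⟦ a′ < t ⟧ ≤ ⟦ a < t ⟧
  ⟦<⟧-antitoneˡ {a} {a′} {t} a≤a′ with a′ ℕ.<? t
  ... | yes a′<t = ≤-reflexive (trans (⟦<⟧-≡1 a′<t) (sym (⟦<⟧-≡1 (ℕ.≤-<-trans a≤a′ a′<t))))
  ... | no  a′≮t = subst (_≤ ⟦ a < t ⟧) (sym (⟦<⟧-≡0 (ℕ.≮⇒≥ a′≮t))) (⟦<⟧-nonNeg a t)

  -- jump a b is the sequence of partial sums of e_a - e_b.
  jump : ℕ → ℕ → ℕ → ℤ
  jump a b t = ⟦ a < t ⟧ - ⟦ b < t ⟧

  jump-nonNeg : ∀ {a b t} → a ℕ.≤ b → + 0 ≤ jump a b t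
  jump-nonNeg {t = t} a≤b = i≤j⇒0≤j-i (⟦<⟧-antitoneˡ {t = t} a≤b)

  jump-≥-1 : ∀ {a b t} → -1ℤ ≤ jump a b t
  jump-≥-1 {a} {b} {t} = +-mono-≤ (⟦<⟧-nonNeg a t) (neg-mono-≤ (⟦<⟧-≤1 b t))

  jump-outside : ∀ {a b t} → a ℕ.< b → t ℕ.≤ a ⊎ b ℕ.< t → jump a b t ≡ + 0
  jump-outside a<b (inj₁ t≤a) = cong₂ _-_ (⟦<⟧-≡0 t≤a) (⟦<⟧-≡0 (ℕ.≤-trans t≤a (ℕ.<⇒≤ a<b)))
  jump-outside a<b (inj₂ b<t) = cong₂ _-_ (⟦<⟧-≡1 (ℕ.<-trans a<b b<t)) (⟦<⟧-≡1 b<t)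

  jump-inside : ∀ {a b t} → b ℕ.< t → t ℕ.≤ a → jump a b t ≡ -1ℤ
  jump-inside b<t t≤a = cong₂ _-_ (⟦<⟧-≡0 t≤a) (⟦<⟧-≡1 b<t)

  jump-at-target : ∀ a b → jump a b b ≡ ⟦ a < b ⟧
  jump-at-target a b = trans (cong (λ r → ⟦ a < b ⟧ - r) (⟦<⟧-≡0 (ℕ.≤-refl {b}))) (+-identityʳ _)

  jump-≤-target : ∀ {a b} t → jump a b t ≤ jump a b b
  jump-≤-target {a} {b} t with b ℕ.<? t
  ... | yes b<t = begin
      ⟦ a < t ⟧ - ⟦ b < t ⟧  ≡⟨ cong (λ r → ⟦ a < t ⟧ - r) (⟦<⟧-≡1 b<t) ⟩
      ⟦ a < t ⟧ - + 1        ≤⟨ i≤j⇒i-j≤0 (⟦<⟧-≤1 a t) ⟩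
      + 0                    ≤⟨ ⟦<⟧-nonNeg a b ⟩
      ⟦ a < b ⟧              ≡⟨ jump-at-target a b ⟨
      jump a b b             ∎
    where open ≤-Reasoning
  ... | no b≮t = begin
      ⟦ a < t ⟧ - ⟦ b < t ⟧  ≡⟨ cong (λ r → ⟦ a < t ⟧ - r) (⟦<⟧-≡0 (ℕ.≮⇒≥ b≮t)) ⟩
      ⟦ a < t ⟧ - + 0        ≡⟨ +-identityʳ _ ⟩
      ⟦ a < t ⟧              ≤⟨ ⟦<⟧-monoʳ (ℕ.≮⇒≥ b≮t) ⟩
      ⟦ a < b ⟧              ≡⟨ jump-at-target a b ⟨
      jump a b b             ∎
    where open ≤-Reasoning

  jump-source<target : ∀ {a b} → a ≢ b → jump a b a < jump a b b
  jump-source<target {a} {b} a≢b with ℕ.<-cmp a b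
  ... | tri< a<b _ _
    rewrite ⟦<⟧-≡0 (ℕ.≤-refl {a}) | ⟦<⟧-≡0 (ℕ.<⇒≤ a<b) | ⟦<⟧-≡1 a<b | ⟦<⟧-≡0 (ℕ.≤-refl {b}) = +<+ ℕ.z<s
  ... | tri≈ _ a≡b _ = contradiction a≡b a≢b
  ... | tri> _ _ b<a
    rewrite ⟦<⟧-≡0 (ℕ.≤-refl {a}) | ⟦<⟧-≡1 b<a | ⟦<⟧-≡0 (ℕ.<⇒≤ b<a) | ⟦<⟧-≡0 (ℕ.≤-refl {b}) = -<+

  jump-minimal-outside : ∀ {a b t} → a ℕ.< b → t ℕ.≤ a ⊎ b ℕ.< t → Minimal (jump a b) t
  jump-minimal-outside {a} {b} a<b out s =
    subst (_≤ jump a b s) (sym (jump-outside a<b out)) (jump-nonNeg {t = s} (ℕ.<⇒≤ a<b))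

  jump-minimal-inside : ∀ {a b t} → b ℕ.< t → t ℕ.≤ a → Minimal (jump a b) t
  jump-minimal-inside {a} {b} b<t t≤a s =
    subst (_≤ jump a b s) (sym (jump-inside b<t t≤a)) (jump-≥-1 {a} {b} {s})

  jump-minimal⇒<target : ∀ {a b t} → a ≢ b → Minimal (jump a b) t → jump a b t < jump a b b
  jump-minimal⇒<target {a} a≢b t-min = ≤-<-trans (t-min a) (jump-source<target a≢b)

  ordered-jump-minimal : ∀ {a b c d} → a ℕ.< b → b ℕ.< c → c ℕ.< d →
                         ∀ t → Minimal (jump a b) t ⊎ Minimal (jump c d) t
  ordered-jump-minimal {b = b} a<b b<c c<d t with t ℕ.≤? b
  ... | yes t≤b = inj₂ (jump-minimal-outside c<d (inj₁ (ℕ.≤-trans t≤b (ℕ.<⇒≤ b<c))))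
  ... | no  t≰b = inj₁ (jump-minimal-outside a<b (inj₂ (ℕ.≰⇒> t≰b)))

  rotated-jump-minimal : ∀ {a b c d} → b ℕ.< c → c ℕ.< d → d ℕ.< a →
                         ∀ t → Minimal (jump a b) t ⊎ Minimal (jump c d) t
  rotated-jump-minimal {a} {c = c} b<c c<d d<a t with t ℕ.≤? c | t ℕ.≤? a
  ... | yes t≤c | _       = inj₂ (jump-minimal-outside c<d (inj₁ t≤c))
  ... | no  t≰c | yes t≤a = inj₁ (jump-minimal-inside (ℕ.<-trans b<c (ℕ.≰⇒> t≰c)) t≤a)
  ... | no  _   | no  t≰a = inj₂ (jump-minimal-outside c<d (inj₂ (ℕ.<-trans d<a (ℕ.≰⇒> t≰a))))

  -- The cyclic arcs (a, b] and (c, d], outside of which the respective jumps are minimal, are disjoint.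
  cyclicOrder-jump-minimal : ∀ {n} {a b c d : Fin n} → CyclicOrder a b c d →
                             ∀ t → Minimal (jump (toℕ a) (toℕ b)) t ⊎ Minimal (jump (toℕ c) (toℕ d)) t
  cyclicOrder-jump-minimal (inj₁ (a<b , b<c , c<d))                 = ordered-jump-minimal a<b b<c c<d
  cyclicOrder-jump-minimal (inj₂ (inj₁ (b<c , c<d , d<a)))          = rotated-jump-minimal b<c c<d d<a
  cyclicOrder-jump-minimal (inj₂ (inj₂ (inj₁ (c<d , d<a , a<b)))) t = Sum.swap (ordered-jump-minimal c<d d<a a<b t)
  cyclicOrder-jump-minimal (inj₂ (inj₂ (inj₂ (d<a , a<b , b<c)))) t = Sum.swap (rotated-jump-minimal d<a a<b b<c t)

  cyclicOrder-distinct : ∀ {n} {a b c d : Fin n} → CyclicOrder a b c d → toℕ a ≢ toℕ b × toℕ c ≢ toℕ d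
  cyclicOrder-distinct (inj₁ (a<b , b<c , c<d))               = ℕ.<⇒≢ a<b , ℕ.<⇒≢ c<d
  cyclicOrder-distinct (inj₂ (inj₁ (b<c , c<d , d<a)))        =
    ℕ.>⇒≢ (ℕ.<-trans b<c (ℕ.<-trans c<d d<a)) , ℕ.<⇒≢ c<d
  cyclicOrder-distinct (inj₂ (inj₂ (inj₁ (c<d , d<a , a<b)))) = ℕ.<⇒≢ a<b , ℕ.<⇒≢ c<d
  cyclicOrder-distinct (inj₂ (inj₂ (inj₂ (d<a , a<b , b<c)))) =
    ℕ.<⇒≢ a<b , ℕ.>⇒≢ (ℕ.<-trans d<a (ℕ.<-trans a<b b<c))

  module Cyclic (n : ℕ) .{{_ : NonZero n}} where

    Periodic : (ℕ → ℤ) → Set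
    Periodic X = ∀ i → X (i ℕ.+ n) ≡ X i

    extend : Vecℤ n → ℕ → ℤ
    extend x i = x (i mod n)

    -- L t x unfolds to L′ (extend x) (toℕ t).
    L′ : (ℕ → ℤ) → ℕ → ℤ
    L′ X s = sumTo n (λ i → + i * X (s ℕ.+ i))

    extend-periodic : ∀ x → Periodic (extend x)
    extend-periodic x i = cong x (Fin.fromℕ<-cong _ _ (ℕ.[m+n]%n≡m%n i n) (ℕ.m%n<n _ n) (ℕ.m%n<n i n))

    toℕ-mod : ∀ {i} → i ℕ.< n → toℕ (i mod n) ≡ i
    toℕ-mod {i} i<n = trans (Fin.toℕ-fromℕ< (ℕ.m%n<n i n)) (ℕ.m<n⇒m%n≡m i<n)

    mutual
      sumVec-extend : ∀ x → sumVec x ≡ sumTo n (extend x)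
      sumVec-extend x = sumTo-cong n (sumVec-summand x)

      -- The summand of sumVec is local to Defs, so it is left to unification.
      sumVec-summand : ∀ x i → i ℕ.< n → _ ≡ extend x i
      sumVec-summand x i i<n with i ℕ.<? n
      ... | yes i<n′ = cong x (Fin.fromℕ<-cong _ _ (sym (ℕ.m<n⇒m%n≡m i<n)) i<n′ (ℕ.m%n<n i n))
      ... | no  i≮n  = contradiction i<n i≮n

    L-cong : ∀ t {x y : Vecℤ n} → (∀ j → x j ≡ y j) → L t x ≡ L t y
    L-cong t x≗y = sumTo-cong n (λ i _ → cong (+ i *_) (x≗y _))

    L-⊖ : ∀ t x y → L t (x ⊖ y) ≡ L t x - L t y
    L-⊖ t x y = trans (sumTo-cong n (λ i _ → distrib (+ i) _ _)) (sumTo-- n _ _)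
      where
      distrib : ∀ c p q → c * (p - q) ≡ c * p - c * q
      distrib = solve-∀

    L-split : ∀ t w x p q → L t (w ⊖ (x ⊕ p ⊖ q)) ≡ L t (w ⊖ x) - L t (p ⊖ q)
    L-split t w x p q = trans (L-cong t (λ j → regroup (w j) (x j) (p j) (q j))) (L-⊖ t (w ⊖ x) (p ⊖ q))
      where
      regroup : ∀ w x p q → w - (x + p - q) ≡ (w - x) - (p - q)
      regroup = solve-∀

    sumTo-rotate : ∀ {X} → Periodic X → ∀ s → sumTo n (λ i → X (s ℕ.+ i)) ≡ sumTo n X
    sumTo-rotate per zero    = refl
    sumTo-rotate {X} per (suc s) = trans (∙-cancelˡ +-0-abelianGroup (X s) _ _ step) (sumTo-rotate per s)
      where
      step : X s + sumTo n (λ i → X (suc s ℕ.+ i)) ≡ X s + sumTo n (λ i → X (s ℕ.+ i))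
      step = begin
        X s + sumTo n (λ i → X (suc s ℕ.+ i))
          ≡⟨ cong₂ _+_ (cong X (ℕ.+-identityʳ s)) (sumTo-cong n (λ i _ → cong X (ℕ.+-suc s i))) ⟨
        X (s ℕ.+ 0) + sumTo n (λ i → X (s ℕ.+ suc i))
          ≡⟨ sumTo-head n (λ i → X (s ℕ.+ i)) ⟨
        sumTo n (λ i → X (s ℕ.+ i)) + X (s ℕ.+ n)
          ≡⟨ cong (λ r → sumTo n (λ i → X (s ℕ.+ i)) + r) (per s) ⟩
        sumTo n (λ i → X (s ℕ.+ i)) + X s
          ≡⟨ +-comm _ (X s) ⟩
        X s + sumTo n (λ i → X (s ℕ.+ i))
          ∎
        where open ≡-Reasoning

    L′-suc : ∀ X t → L′ X t + + n * X (t ℕ.+ n) ≡ sumTo n (λ i → X (suc t ℕ.+ i)) + L′ X (suc t)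
    L′-suc X t = begin
      sumTo (suc n) (λ i → + i * X (t ℕ.+ i))
        ≡⟨ sumTo-head n _ ⟩
      + 0 * X (t ℕ.+ 0) + sumTo n (λ i → + suc i * X (t ℕ.+ suc i))
        ≡⟨ cong₂ _+_ (*-zeroˡ (X (t ℕ.+ 0))) (sumTo-cong n (λ i _ → term i)) ⟩
      + 0 + sumTo n (λ i → X (suc t ℕ.+ i) + + i * X (suc t ℕ.+ i))
        ≡⟨ trans (+-identityˡ _) (sumTo-+ n _ _) ⟩
      sumTo n (λ i → X (suc t ℕ.+ i)) + L′ X (suc t)
        ∎
      where
      open ≡-Reasoning
      unfold : ∀ i x → (+ 1 + i) * x ≡ x + i * x
      unfold = solve-∀
      term : ∀ i → + suc i * X (t ℕ.+ suc i) ≡ X (suc t ℕ.+ i) + + i * X (suc t ℕ.+ i)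
      term i rewrite ℕ.+-suc t i = trans (cong (_* X (suc (t ℕ.+ i))) (pos-+ 1 i)) (unfold (+ i) _)

    module _ {X : ℕ → ℤ} (per : Periodic X) (sum≡0 : sumTo n X ≡ + 0) where

      L′-step : ∀ t → L′ X (suc t) ≡ L′ X t + + n * X t
      L′-step t = begin
        L′ X (suc t)
          ≡⟨ +-identityˡ _ ⟨
        + 0 + L′ X (suc t)
          ≡⟨ cong (_+ L′ X (suc t)) (trans (sumTo-rotate per (suc t)) sum≡0) ⟨
        sumTo n (λ i → X (suc t ℕ.+ i)) + L′ X (suc t)
          ≡⟨ L′-suc X t ⟨
        L′ X t + + n * X (t ℕ.+ n)
          ≡⟨ cong (λ x → L′ X t + + n * x) (per t) ⟩
        L′ X t + + n * X t
          ∎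
        where open ≡-Reasoning

      L′-shift : ∀ s m → L′ X (s ℕ.+ m) ≡ L′ X s + + n * sumTo m (λ i → X (s ℕ.+ i))
      L′-shift s zero    = begin
        L′ X (s ℕ.+ 0)      ≡⟨ cong (L′ X) (ℕ.+-identityʳ s) ⟩
        L′ X s              ≡⟨ +-identityʳ _ ⟨
        L′ X s + + 0        ≡⟨ cong (λ r → L′ X s + r) (*-zeroʳ (+ n)) ⟨
        L′ X s + + n * + 0  ∎
        where open ≡-Reasoning
      L′-shift s (suc m) = begin
        L′ X (s ℕ.+ suc m)
          ≡⟨ cong (L′ X) (ℕ.+-suc s m) ⟩
        L′ X (suc (s ℕ.+ m))
          ≡⟨ L′-step (s ℕ.+ m) ⟩
        L′ X (s ℕ.+ m) + + n * X (s ℕ.+ m)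
          ≡⟨ cong (_+ + n * X (s ℕ.+ m)) (L′-shift s m) ⟩
        L′ X s + + n * sumTo m (λ i → X (s ℕ.+ i)) + + n * X (s ℕ.+ m)
          ≡⟨ +-assoc (L′ X s) _ _ ⟩
        L′ X s + (+ n * sumTo m (λ i → X (s ℕ.+ i)) + + n * X (s ℕ.+ m))
          ≡⟨ cong (λ r → L′ X s + r) (*-distribˡ-+ (+ n) _ _) ⟨
        L′ X s + + n * sumTo (suc m) (λ i → X (s ℕ.+ i))
          ∎
        where open ≡-Reasoning

      L′-periodic : ∀ t → L′ X (t ℕ.+ n) ≡ L′ X t
      L′-periodic t = begin
        L′ X (t ℕ.+ n)                               ≡⟨ L′-shift t n ⟩
        L′ X t + + n * sumTo n (λ i → X (t ℕ.+ i))  ≡⟨ cong (λ x → L′ X t + + n * x) (sumTo-rotate per t) ⟩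
        L′ X t + + n * sumTo n X                     ≡⟨ cong (λ x → L′ X t + + n * x) sum≡0 ⟩
        L′ X t + + n * + 0                           ≡⟨ cong (λ r → L′ X t + r) (*-zeroʳ (+ n)) ⟩
        L′ X t + + 0                                 ≡⟨ +-identityʳ _ ⟩
        L′ X t                                       ∎
        where open ≡-Reasoning

      L′-≤-shift : ∀ s m → + 0 ≤ sumTo m (λ i → X (s ℕ.+ i)) → L′ X s ≤ L′ X (s ℕ.+ m)
      L′-≤-shift s m prefix≥0 = begin
        L′ X s                                          ≡⟨ +-identityʳ _ ⟨
        L′ X s + + 0                                    ≡⟨ cong (λ r → L′ X s + r) (*-zeroʳ (+ n)) ⟨
        L′ X s + + n * + 0                              ≤⟨ +-monoʳ-≤ (L′ X s) (*-monoˡ-≤-nonNeg (+ n) prefix≥0) ⟩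
        L′ X s + + n * sumTo m (λ i → X (s ℕ.+ i))      ≡⟨ L′-shift s m ⟨
        L′ X (s ℕ.+ m)                                  ∎
        where open ≤-Reasoning

      -- For t < s compare with t + n instead, using periodicity of L′ X.
      L′-minimal : (s : Fin n) → (∀ m → m ℕ.≤ n → + 0 ≤ sumTo m (λ i → X (toℕ s ℕ.+ i))) →
                   Minimal (λ (t : Fin n) → L′ X (toℕ t)) s
      L′-minimal s prefix≥0 t with toℕ s ℕ.≤? toℕ t
      ... | yes s≤t = subst (λ r → L′ X (toℕ s) ≤ L′ X r) (ℕ.m+[n∸m]≡n s≤t)
                        (L′-≤-shift (toℕ s) _ (prefix≥0 _ t∸s≤n))
        where
        t∸s≤n : toℕ t ∸ toℕ s ℕ.≤ n
        t∸s≤n = ℕ.≤-trans (ℕ.m∸n≤m (toℕ t) (toℕ s)) (ℕ.<⇒≤ (Fin.toℕ<n t))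
      ... | no  s≰t = subst (L′ X (toℕ s) ≤_) (L′-periodic (toℕ t))
                        (subst (λ r → L′ X (toℕ s) ≤ L′ X r) (ℕ.m+[n∸m]≡n s≤t+n)
                          (L′-≤-shift (toℕ s) _ (prefix≥0 _ t+n∸s≤n)))
        where
        s≤t+n : toℕ s ℕ.≤ toℕ t ℕ.+ n
        s≤t+n = ℕ.≤-trans (ℕ.<⇒≤ (Fin.toℕ<n s)) (ℕ.m≤n+m n (toℕ t))
        t+n∸s≤n : toℕ t ℕ.+ n ∸ toℕ s ℕ.≤ n
        t+n∸s≤n = ℕ.≤-trans (ℕ.∸-monoʳ-≤ (toℕ t ℕ.+ n) (ℕ.<⇒≤ (ℕ.≰⇒> s≰t)))
                            (ℕ.≤-reflexive (ℕ.m+n∸m≡n (toℕ t) n))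

    extend-eᵢ-on : ∀ (a : Fin n) {i} → toℕ a ≡ i → i ℕ.< n → extend (eᵢ a) i ≡ + 1
    extend-eᵢ-on a {i} a≡i i<n with (i mod n) Fin.≟ a
    ... | yes _   = refl
    ... | no  i≢a = contradiction (Fin.toℕ-injective (trans (toℕ-mod i<n) (sym a≡i))) i≢a

    extend-eᵢ-off : ∀ (a : Fin n) {i} → toℕ a ≢ i → i ℕ.< n → extend (eᵢ a) i ≡ + 0
    extend-eᵢ-off a {i} a≢i i<n with (i mod n) Fin.≟ a
    ... | no  _   = refl
    ... | yes i≡a = contradiction (trans (sym (cong toℕ i≡a)) (toℕ-mod i<n)) a≢i

    sumTo-extend-eᵢ : ∀ (a : Fin n) m → m ℕ.≤ n → sumTo m (extend (eᵢ a)) ≡ ⟦ toℕ a < m ⟧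
    sumTo-extend-eᵢ a zero    _   = sym (⟦<⟧-≡0 {toℕ a} z≤n)
    sumTo-extend-eᵢ a (suc m) m<n rewrite sumTo-extend-eᵢ a m (ℕ.<⇒≤ m<n) with ℕ.<-cmp (toℕ a) m
    ... | tri< a<m _ _
      rewrite ⟦<⟧-≡1 a<m | extend-eᵢ-off a (ℕ.<⇒≢ a<m) m<n | ⟦<⟧-≡1 (ℕ.m<n⇒m<1+n a<m) = refl
    ... | tri≈ _ a≡m _
      rewrite ⟦<⟧-≡0 (ℕ.≤-reflexive (sym a≡m)) | extend-eᵢ-on a a≡m m<n | ⟦<⟧-≡1 (ℕ.≤-reflexive (cong suc a≡m)) = refl
    ... | tri> _ _ m<a
      rewrite ⟦<⟧-≡0 (ℕ.<⇒≤ m<a) | extend-eᵢ-off a (ℕ.>⇒≢ m<a) m<n | ⟦<⟧-≡0 {toℕ a} {suc m} m<a = refl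

    sumTo-extend-eᵢ⊖eᵢ : ∀ (a b : Fin n) m → m ℕ.≤ n →
                         sumTo m (extend (eᵢ a ⊖ eᵢ b)) ≡ jump (toℕ a) (toℕ b) m
    sumTo-extend-eᵢ⊖eᵢ a b m m≤n = trans (sumTo-- m (extend (eᵢ a)) (extend (eᵢ b)))
                                         (cong₂ _-_ (sumTo-extend-eᵢ a m m≤n) (sumTo-extend-eᵢ b m m≤n))

    L-eᵢ⊖eᵢ : ∀ (a b t : Fin n) →
              L t (eᵢ a ⊖ eᵢ b) ≡ L′ (extend (eᵢ a ⊖ eᵢ b)) 0 + + n * jump (toℕ a) (toℕ b) (toℕ t)
    L-eᵢ⊖eᵢ a b t =
      trans (L′-shift (extend-periodic (eᵢ a ⊖ eᵢ b)) sum≡0 0 (toℕ t))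
            (cong (λ x → L′ (extend (eᵢ a ⊖ eᵢ b)) 0 + + n * x)
                  (sumTo-extend-eᵢ⊖eᵢ a b (toℕ t) (ℕ.<⇒≤ (Fin.toℕ<n t))))
      where
      sum≡0 : sumTo n (extend (eᵢ a ⊖ eᵢ b)) ≡ + 0
      sum≡0 rewrite sumTo-extend-eᵢ⊖eᵢ a b n ℕ.≤-refl | ⟦<⟧-≡1 (Fin.toℕ<n a) | ⟦<⟧-≡1 (Fin.toℕ<n b) = refl

    instance
      +n-positive : Positive (+ n)
      +n-positive = positive (+<+ (ℕ.>-nonZero⁻¹ n))

    L-eᵢ⊖eᵢ-mono : ∀ (a b : Fin n) {t s} → jump (toℕ a) (toℕ b) (toℕ t) ≤ jump (toℕ a) (toℕ b) (toℕ s) →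
                   L t (eᵢ a ⊖ eᵢ b) ≤ L s (eᵢ a ⊖ eᵢ b)
    L-eᵢ⊖eᵢ-mono a b {t} {s} jt≤js rewrite L-eᵢ⊖eᵢ a b t | L-eᵢ⊖eᵢ a b s =
      +-monoʳ-≤ (L′ (extend (eᵢ a ⊖ eᵢ b)) 0) (*-monoˡ-≤-nonNeg (+ n) jt≤js)

    L-eᵢ⊖eᵢ-mono-< : ∀ (a b : Fin n) {t s} → jump (toℕ a) (toℕ b) (toℕ t) < jump (toℕ a) (toℕ b) (toℕ s) →
                     L t (eᵢ a ⊖ eᵢ b) < L s (eᵢ a ⊖ eᵢ b)
    L-eᵢ⊖eᵢ-mono-< a b {t} {s} jt<js rewrite L-eᵢ⊖eᵢ a b t | L-eᵢ⊖eᵢ a b s =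
      +-monoʳ-< (L′ (extend (eᵢ a ⊖ eᵢ b)) 0) (*-monoˡ-<-pos (+ n) jt<js)

    extend-interval : ∀ k (j : Fin n) {i} → i ℕ.< n → extend (e (interval k j)) (toℕ j ℕ.+ i) ≡ ⟦ i < k ⟧
    extend-interval k j {i} i<n =
      trans (cong (λ β → if β then + 1 else + 0) (lookup∘tabulate _ ((toℕ j ℕ.+ i) mod n)))
            (cong ⟦_< k ⟧ offset)
      where
      open ≡-Reasoning
      x = toℕ j ℕ.+ i
      y = n ∸ toℕ j
      offset : (toℕ (x mod n) ℕ.+ y) % n ≡ i
      offset = begin
        (toℕ (x mod n) ℕ.+ y) % n        ≡⟨ cong (λ r → (r ℕ.+ y) % n) (Fin.toℕ-fromℕ< (ℕ.m%n<n x n)) ⟩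
        (x % n ℕ.+ y) % n                ≡⟨ ℕ.%-distribˡ-+ (x % n) y n ⟩
        (x % n % n ℕ.+ y % n) % n        ≡⟨ cong (λ r → (r ℕ.+ y % n) % n) (ℕ.m%n%n≡m%n x n) ⟩
        (x % n ℕ.+ y % n) % n            ≡⟨ ℕ.%-distribˡ-+ x y n ⟨
        (x ℕ.+ y) % n                    ≡⟨ cong (_% n) (ℕ.+-comm x y) ⟩
        (y ℕ.+ (toℕ j ℕ.+ i)) % n        ≡⟨ cong (_% n) (ℕ.+-assoc y (toℕ j) i) ⟨
        (y ℕ.+ toℕ j ℕ.+ i) % n          ≡⟨ cong (λ r → (r ℕ.+ i) % n) (ℕ.m∸n+n≡m (ℕ.<⇒≤ (Fin.toℕ<n j))) ⟩
        (n ℕ.+ i) % n                    ≡⟨ cong (_% n) (ℕ.+-comm n i) ⟩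
        (i ℕ.+ n) % n                    ≡⟨ ℕ.[m+n]%n≡m%n i n ⟩
        i % n                            ≡⟨ ℕ.m<n⇒m%n≡m i<n ⟩
        i                                ∎

    sumTo-⟦<⟧ : ∀ k m → sumTo m (λ i → ⟦ i < k ⟧) ≡ + (m ℕ.⊓ k)
    sumTo-⟦<⟧ k zero    = refl
    sumTo-⟦<⟧ k (suc m) with m ℕ.<? k
    ... | yes m<k rewrite sumTo-⟦<⟧ k m | ⟦<⟧-≡1 m<k | ℕ.m≤n⇒m⊓n≡m (ℕ.<⇒≤ m<k) | ℕ.m≤n⇒m⊓n≡m m<k =
      cong +_ (ℕ.+-comm m 1)
    ... | no  m≮k rewrite sumTo-⟦<⟧ k m | ⟦<⟧-≡0 (ℕ.≮⇒≥ m≮k) | ℕ.m≥n⇒m⊓n≡n (ℕ.≮⇒≥ m≮k)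
                        | ℕ.m≥n⇒m⊓n≡n (ℕ.m≤n⇒m≤1+n (ℕ.≮⇒≥ m≮k)) = +-identityʳ (+ k)

    Δ-partialSum-≤ : ∀ {k u} → InΔ k n u → ∀ s m → m ℕ.≤ n →
                     sumTo m (λ i → extend u (s ℕ.+ i)) ≤ + (m ℕ.⊓ k)
    Δ-partialSum-≤ {k} {u} (bounds , sum≡k) s m m≤n with ℕ.≤-total m k
    ... | inj₁ m≤k rewrite ℕ.m≤n⇒m⊓n≡m m≤k =
      ≤-trans (sumTo-mono m (λ i _ → proj₂ (bounds _))) (≤-reflexive (sumTo-one m))
    ... | inj₂ k≤m rewrite ℕ.m≥n⇒m⊓n≡n k≤m = begin
      sumTo m (λ i → extend u (s ℕ.+ i))  ≤⟨ sumTo-monoˡ _ (λ i → proj₁ (bounds _)) m≤n ⟩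
      sumTo n (λ i → extend u (s ℕ.+ i))  ≡⟨ sumTo-rotate (extend-periodic u) s ⟩
      sumTo n (extend u)                  ≡⟨ trans (sym (sumVec-extend u)) sum≡k ⟩
      + k                                 ∎
      where open ≤-Reasoning

    interval-minimal : ∀ {k u} → k ℕ.≤ n → InΔ k n u → ∀ j → Minimal (λ t → L t (e (interval k j) ⊖ u)) j
    interval-minimal {k} {u} k≤n Δu j =
      L′-minimal (extend-periodic (e I ⊖ u)) sum≡0 j partialSum≥0
      where
      I = interval k j
      partialSum-e : ∀ m → m ℕ.≤ n → sumTo m (λ i → extend (e I) (toℕ j ℕ.+ i)) ≡ + (m ℕ.⊓ k)
      partialSum-e m m≤n = trans (sumTo-cong m (λ i i<m → extend-interval k j (ℕ.<-≤-trans i<m m≤n))) (sumTo-⟦<⟧ k m)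
      partialSum≥0 : ∀ m → m ℕ.≤ n → + 0 ≤ sumTo m (λ i → extend (e I ⊖ u) (toℕ j ℕ.+ i))
      partialSum≥0 m m≤n = subst (+ 0 ≤_) (sym (sumTo-- m _ _))
        (i≤j⇒0≤j-i (subst (_ ≤_) (sym (partialSum-e m m≤n)) (Δ-partialSum-≤ Δu (toℕ j) m m≤n)))
      sum≡0 : sumTo n (extend (e I ⊖ u)) ≡ + 0
      sum≡0 = begin
        sumTo n (extend (e I ⊖ u))
          ≡⟨ sumTo-- n _ _ ⟩
        sumTo n (extend (e I)) - sumTo n (extend u)
          ≡⟨ cong₂ _-_ (sumTo-rotate (extend-periodic (e I)) (toℕ j)) (sumVec-extend u) ⟨
        sumTo n (λ i → extend (e I) (toℕ j ℕ.+ i)) - sumVec u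
          ≡⟨ cong₂ _-_ (partialSum-e n ℕ.≤-refl) (proj₂ Δu) ⟩
        + (n ℕ.⊓ k) - + k
          ≡⟨ cong (λ r → + r - + k) (ℕ.m≥n⇒m⊓n≡n k≤n) ⟩
        + k - + k
          ≡⟨ +-inverseʳ (+ k) ⟩
        + 0
          ∎
        where open ≡-Reasoning

  i<j⇒i-j<0 : ∀ {i j} → i < j → i - j < + 0
  i<j⇒i-j<0 {i} {j} i<j = subst (i - j <_) (+-inverseʳ j) (+-monoˡ-< (- j) i<j)

  toℚᵘ-/ : ∀ p m → ℚ.toℚᵘ (p / suc m) ℚᵘ.≃ mkℚᵘ p m
  toℚᵘ-/ p m = ℚ.toℚᵘ-fromℚᵘ (mkℚᵘ p m)

  /-+ : ∀ n .{{_ : NonZero n}} p q → p / n ℚ.+ q / n ≡ (p + q) / n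
  /-+ (suc m) p q = ℚ.toℚᵘ-injective (begin
    ℚ.toℚᵘ (p / suc m ℚ.+ q / suc m)            ≈⟨ ℚ.toℚᵘ-homo-+ (p / suc m) (q / suc m) ⟩
    ℚ.toℚᵘ (p / suc m) ℚᵘ.+ ℚ.toℚᵘ (q / suc m)  ≈⟨ ℚᵘ.+-cong (toℚᵘ-/ p m) (toℚᵘ-/ q m) ⟩
    mkℚᵘ p m ℚᵘ.+ mkℚᵘ q m                      ≈⟨ *≡* cross-multiplied ⟩
    mkℚᵘ (p + q) m                              ≈⟨ toℚᵘ-/ (p + q) m ⟨
    ℚ.toℚᵘ ((p + q) / suc m)                    ∎)
    where
    open ℚᵘ.≃-Reasoning
    regroup : ∀ p q d → (p * d + q * d) * d ≡ (p + q) * (d * d)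
    regroup = solve-∀
    cross-multiplied : (p * + suc m + q * + suc m) * + suc m ≡ (p + q) * + (suc m ℕ.* suc m)
    cross-multiplied = trans (regroup p q (+ suc m)) (cong ((p + q) *_) (sym (pos-* (suc m) (suc m))))

  neg-/ : ∀ n .{{_ : NonZero n}} q → ℚ.- (q / n) ≡ (- q) / n
  neg-/ (suc m) q = ℚ.toℚᵘ-injective (begin
    ℚ.toℚᵘ (ℚ.- (q / suc m))   ≈⟨ ℚ.toℚᵘ-homo‿- (q / suc m) ⟩
    ℚᵘ.- ℚ.toℚᵘ (q / suc m)    ≈⟨ ℚᵘ.-‿cong (toℚᵘ-/ q m) ⟩
    mkℚᵘ (- q) m               ≈⟨ toℚᵘ-/ (- q) m ⟨
    ℚ.toℚᵘ ((- q) / suc m)     ∎)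
    where open ℚᵘ.≃-Reasoning

  /-- : ∀ n .{{_ : NonZero n}} p q → p / n ℚ.- q / n ≡ (p - q) / n
  /-- n p q = trans (cong (p / n ℚ.+_) (neg-/ n q)) (/-+ n p (- q))

  /-nonPos : ∀ n .{{_ : NonZero n}} {p} → p ≤ + 0 → p / n ℚ.≤ 0ℚ
  /-nonPos (suc m) {p} p≤0 = subst (p / suc m ℚ.≤_) (ℚ.0/n≡0 (suc m)) (ℚ.toℚᵘ-cancel-≤
    (ℚᵘ.≤-respʳ-≃ (ℚᵘ.≃-sym (toℚᵘ-/ (+ 0) m)) (ℚᵘ.≤-respˡ-≃ (ℚᵘ.≃-sym (toℚᵘ-/ p m))
      (*≤* (*-monoʳ-≤-nonNeg (+ suc m) p≤0)))))

  /-neg : ∀ n .{{_ : NonZero n}} {p} → p < + 0 → p / n ℚ.< 0ℚ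
  /-neg (suc m) {p} p<0 = subst (p / suc m ℚ.<_) (ℚ.0/n≡0 (suc m)) (ℚ.toℚᵘ-cancel-<
    (ℚᵘ.<-respʳ-≃ (ℚᵘ.≃-sym (toℚᵘ-/ (+ 0) m)) (ℚᵘ.<-respˡ-≃ (ℚᵘ.≃-sym (toℚᵘ-/ p m))
      (*<* (*-monoʳ-<-pos (+ suc m) p<0)))))

  module _ {n : ℕ} .{{_ : NonZero n}} (J : Subset n) (a b c d : Fin n) where
    open Cyclic n

    J+ab J+cd J+ab+cd : Vecℤ n
    J+ab    = e J ⊕ eᵢ a ⊖ eᵢ b
    J+cd    = e J ⊕ eᵢ c ⊖ eᵢ d
    J+ab+cd = e J ⊕ eᵢ a ⊖ eᵢ b ⊕ eᵢ c ⊖ eᵢ d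

    -- M I u is -n ρ_u(e_I).
    M : Subset n → Vecℤ n → ℤ
    M I u = minOver n (λ t → L t (e I ⊖ u))

    private
      A C : Fin n → ℤ
      A t = L t (eᵢ a ⊖ eᵢ b)
      C t = L t (eᵢ c ⊖ eᵢ d)
      H : Subset n → Fin n → ℤ
      H I t = L t (e I ⊖ e J)

    L-J+ab : ∀ I t → L t (e I ⊖ J+ab) ≡ H I t - A t
    L-J+ab I t = L-split t (e I) (e J) (eᵢ a) (eᵢ b)

    L-J+cd : ∀ I t → L t (e I ⊖ J+cd) ≡ H I t - C t
    L-J+cd I t = L-split t (e I) (e J) (eᵢ c) (eᵢ d)

    L-J+ab+cd : ∀ I t → L t (e I ⊖ J+ab+cd) ≡ H I t - A t - C t
    L-J+ab+cd I t = trans (L-split t (e I) J+ab (eᵢ c) (eᵢ d)) (cong (_- C t) (L-J+ab I t))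

    𝒪-as-fraction : ∀ I → 𝒪 a b c d J I ≡ ((M I J+ab + M I J+cd) - (M I (e J) + M I J+ab+cd)) / n
    𝒪-as-fraction I = begin
      ((m₁ / n ℚ.+ m₂ / n) ℚ.- m₃ / n) ℚ.- m₄ / n
        ≡⟨ cong (λ r → (r ℚ.- m₃ / n) ℚ.- m₄ / n) (/-+ n m₁ m₂) ⟩
      ((m₁ + m₂) / n ℚ.- m₃ / n) ℚ.- m₄ / n
        ≡⟨ cong (ℚ._- m₄ / n) (/-- n (m₁ + m₂) m₃) ⟩
      ((m₁ + m₂ - m₃) / n) ℚ.- m₄ / n
        ≡⟨ /-- n (m₁ + m₂ - m₃) m₄ ⟩
      (m₁ + m₂ - m₃ - m₄) / n
        ≡⟨ cong (_/ n) (regroup (M I (e J)) (M I J+ab+cd) (M I J+ab) (M I J+cd)) ⟩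
      ((M I J+ab + M I J+cd) - (M I (e J) + M I J+ab+cd)) / n
        ∎
      where
      open ≡-Reasoning
      m₁ = - M I (e J)
      m₂ = - M I J+ab+cd
      m₃ = - M I J+ab
      m₄ = - M I J+cd
      regroup : ∀ x y z w → - x + - y - - z - - w ≡ (z + w) - (x + y)
      regroup = solve-∀

    M-exchange : CyclicOrder a b c d → ∀ I → M I J+ab + M I J+cd ≤ M I (e J) + M I J+ab+cd
    M-exchange cyc I = begin
      M I J+ab + M I J+cd
        ≡⟨ cong₂ _+_ (minOver-cong (L-J+ab I)) (minOver-cong (L-J+cd I)) ⟩
      minOver n (λ t → H I t - A t) + minOver n (λ t → H I t - C t)
        ≤⟨ minOver-exchange (H I) A C A∨C-minimal ⟩
      minOver n (H I) + minOver n (λ t → H I t - A t - C t)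
        ≡⟨ cong (λ r → M I (e J) + r) (minOver-cong (L-J+ab+cd I)) ⟨
      M I (e J) + M I J+ab+cd
        ∎
      where
      open ≤-Reasoning
      A∨C-minimal : ∀ t → Minimal A t ⊎ Minimal C t
      A∨C-minimal t = Sum.map (λ t-min s → L-eᵢ⊖eᵢ-mono a b (t-min (toℕ s)))
                              (λ t-min s → L-eᵢ⊖eᵢ-mono c d (t-min (toℕ s)))
                              (cyclicOrder-jump-minimal cyc (toℕ t))

    M-exchange-strict : CyclicOrder a b c d → M J J+ab + M J J+cd < M J (e J) + M J J+ab+cd
    M-exchange-strict cyc = begin-strict
      M J J+ab + M J J+cd
        ≡⟨ cong₂ _+_ (minOver-cong (L-J+ab J)) (minOver-cong (L-J+cd J)) ⟩
      minOver n (λ t → H J t - A t) + minOver n (λ t → H J t - C t)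
        <⟨ minOver-exchange-strict (H J) A C b d H-self A≤A-b C≤C-d A∨C-below-target ⟩
      minOver n (H J) + minOver n (λ t → H J t - A t - C t)
        ≡⟨ cong (λ r → M J (e J) + r) (minOver-cong (L-J+ab+cd J)) ⟨
      M J (e J) + M J J+ab+cd
        ∎
      where
      open ≤-Reasoning
      H-self : ∀ t → H J t ≡ + 0
      H-self t = trans (L-⊖ t (e J) (e J)) (+-inverseʳ (L t (e J)))
      A≤A-b : ∀ t → A t ≤ A b
      A≤A-b t = L-eᵢ⊖eᵢ-mono a b (jump-≤-target (toℕ t))
      C≤C-d : ∀ t → C t ≤ C d
      C≤C-d t = L-eᵢ⊖eᵢ-mono c d (jump-≤-target (toℕ t))
      A∨C-below-target : ∀ t → A t < A b ⊎ C t < C d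
      A∨C-below-target t with cyclicOrder-jump-minimal cyc (toℕ t) | cyclicOrder-distinct cyc
      ... | inj₁ t-min | a≢b , _ = inj₁ (L-eᵢ⊖eᵢ-mono-< a b (jump-minimal⇒<target {t = toℕ t} a≢b t-min))
      ... | inj₂ t-min | _ , c≢d = inj₂ (L-eᵢ⊖eᵢ-mono-< c d (jump-minimal⇒<target {t = toℕ t} c≢d t-min))

    M-exchange-frozen : ∀ {k} → k ℕ.≤ n → InΔ k n (e J) → InΔ k n J+ab+cd → InΔ k n J+ab → InΔ k n J+cd →
                        ∀ j → let I = interval k j in M I J+ab + M I J+cd ≡ M I (e J) + M I J+ab+cd
    M-exchange-frozen {k} k≤n ΔJ ΔJ+ab+cd ΔJ+ab ΔJ+cd j = begin
      M I J+ab + M I J+cd                  ≡⟨ cong₂ _+_ (M-at-j ΔJ+ab) (M-at-j ΔJ+cd) ⟩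
      L j (e I ⊖ J+ab) + L j (e I ⊖ J+cd)  ≡⟨ cong₂ _+_ (L-J+ab I j) (L-J+cd I j) ⟩
      (H I j - A j) + (H I j - C j)        ≡⟨ regroup (H I j) (A j) (C j) ⟩
      H I j + (H I j - A j - C j)          ≡⟨ cong (λ r → H I j + r) (L-J+ab+cd I j) ⟨
      H I j + L j (e I ⊖ J+ab+cd)          ≡⟨ cong₂ _+_ (M-at-j ΔJ) (M-at-j ΔJ+ab+cd) ⟨
      M I (e J) + M I J+ab+cd              ∎
      where
      open ≡-Reasoning
      I = interval k j
      M-at-j : ∀ {u} → InΔ k n u → M I u ≡ L j (e I ⊖ u)
      M-at-j Δu = minOver-minimal (interval-minimal k≤n Δu j)
      regroup : ∀ h x y → (h - x) + (h - y) ≡ h + (h - x - y)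
      regroup = solve-∀

    𝒪-nonPos : CyclicOrder a b c d → ∀ I → 𝒪 a b c d J I ℚ.≤ 0ℚ
    𝒪-nonPos cyc I = subst (ℚ._≤ 0ℚ) (sym (𝒪-as-fraction I)) (/-nonPos n (i≤j⇒i-j≤0 (M-exchange cyc I)))

    𝒪-neg-at-J : CyclicOrder a b c d → 𝒪 a b c d J J ℚ.< 0ℚ
    𝒪-neg-at-J cyc = subst (ℚ._< 0ℚ) (sym (𝒪-as-fraction J)) (/-neg n (i<j⇒i-j<0 (M-exchange-strict cyc)))

    𝒪-zero-at-frozen : ∀ {k} → k ℕ.≤ n → InΔ k n (e J) → InΔ k n J+ab+cd → InΔ k n J+ab → InΔ k n J+cd →
                       ∀ j → 𝒪 a b c d J (interval k j) ≡ 0ℚ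
    𝒪-zero-at-frozen {k} k≤n ΔJ ΔJ+ab+cd ΔJ+ab ΔJ+cd j = begin
      𝒪 a b c d J I                      ≡⟨ 𝒪-as-fraction I ⟩
      ((M I J+ab + M I J+cd) - rhs) / n  ≡⟨ cong (λ r → (r - rhs) / n) exchange ⟩
      (rhs - rhs) / n                    ≡⟨ cong (_/ n) (+-inverseʳ rhs) ⟩
      + 0 / n                            ≡⟨ ℚ.0/n≡0 n ⟩
      0ℚ                                 ∎
      where
      open ≡-Reasoning
      I = interval k j
      rhs = M I (e J) + M I J+ab+cd
      exchange : M I J+ab + M I J+cd ≡ rhs
      exchange = M-exchange-frozen k≤n ΔJ ΔJ+ab+cd ΔJ+ab ΔJ+cd j

open import Data.Nat using (ℕ; NonZero; _≤_; _+_)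
open import Data.Fin using (Fin)
open import Data.Fin.Subset using (Subset; ∣_∣)
open import Data.Rational using (ℚ; 0ℚ; _<_) renaming (_≤_ to _≤ℚ_)
open import Data.Product using (_×_; ∃; _,_)
open import Relation.Binary.PropositionalEquality using (_≡_)
open import Relation.Nullary using (¬_)
import Data.Nat.Properties as ℕ

mainTheorem6 : (n k : ℕ) .{{_ : NonZero n}} → 2 ≤ k → k + 2 ≤ n → (J : Subset n) → ∣ J ∣ ≡ k → ¬ Frozen k J → (a b c d : Fin n) → CyclicOrder a b c d → InΔ k n (e J) → InΔ k n (e J ⊕ eᵢ a ⊖ eᵢ b ⊕ eᵢ c ⊖ eᵢ d) → InΔ k n (e J ⊕ eᵢ a ⊖ eᵢ b) → InΔ k n (e J ⊕ eᵢ c ⊖ eᵢ d)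
    → ((I : Subset n) → ∣ I ∣ ≡ k → 𝒪 a b c d J I ≤ℚ 0ℚ)
      × (∃ λ (I : Subset n) → (∣ I ∣ ≡ k) × (𝒪 a b c d J I < 0ℚ))
      × ((j : Fin n) → 𝒪 a b c d J (interval k j) ≡ 0ℚ)
mainTheorem6 n k _ k+2≤n J ∣J∣≡k _ a b c d cyc ΔJ ΔJ+ab+cd ΔJ+ab ΔJ+cd =
    (λ I _ → 𝒪-nonPos J a b c d cyc I)
  , (J , ∣J∣≡k , 𝒪-neg-at-J J a b c d cyc)
  , 𝒪-zero-at-frozen J a b c d k≤n ΔJ ΔJ+ab+cd ΔJ+ab ΔJ+cd
  where
  k≤n : k ≤ n
  k≤n = ℕ.≤-trans (ℕ.m≤m+n k 2) k+2≤n
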